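{- Let $G=(V,E)$ be a prime permutation graph, let $(<_1,<_2)$ be a realizer of $G$, and let $w$ be the first element of $<_1$. Then the relations $\vartriangleleft_1^w$ and $\vartriangleleft_2^w$ are strict linear orders on $V$.
   Context: A realizer of $G$ is a pair $(<_1,<_2)$ of strict linear orders on $V$ such that distinct $u,v$ are adjacent iff they occur in different order in $<_1$ and $<_2$; permutation graphs are graphs having a realizer. $G$ is prime if its only modules are $V$ and singletons, where a module is a non-empty $M\subseteq V$ with $\{u,x\}\in E\iff\{u,x'\}\in E$ for all $u\notin M$, $x,x'\in M$. For binary relations $\vartriangleleft_1,\vartriangleleft_2$ on $V$, their closure under $E$ is $(\vartriangleleft_1^E,\vartriangleleft_2^E)$ with $\vartriangleleft_i^E=\vartriangleleft_i\cup\{(v,u)\mid u\vartriangleleft_{3-i}v,\ \{u,v\}\in E\}\cup\{(u,v)\mid u\vartriangleleft_{3-i}v,\ \{u,v\}\notin E\}$; $(\cdot,\cdot)^T$ takes the transitive closure of each component. Define $\vartriangleleft_{1,0}^w=\{(w,v)\mid v\in V,v\neq w\}$, $\vartriangleleft_{2,0}^w=\emptyset$, and $(\vartriangleleft_{1,k+1}^w,\vartriangleleft_{2,k+1}^w)=((\vartriangleleft_{1,k}^w,\vartriangleleft_{2,k}^w)^E)^T$ for $k\ge0$. These increase with $k$; $\vartriangleleft_i^w$ denotes $\vartriangleleft_{i,m}^w$ for $m$ such that the sequence has stabilized. -}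

module Defs where

open import Level using (0ℓ)
open import Data.Nat using (ℕ; zero; suc)
open import Data.Fin using (Fin)
open import Data.Fin.Subset using (Subset; _∈_; _∉_; Nonempty; ⊤; ⁅_⁆)
open import Data.Product using (_×_; _,_; ∃; proj₁; proj₂)
open import Data.Sum using (_⊎_)
open import Data.Empty using (⊥)
open import Relation.Nullary using (¬_)
open import Relation.Binary.Core using (Rel)
open import Relation.Binary.Structures using (IsStrictTotalOrder)
open import Relation.Binary.PropositionalEquality using (_≡_)
open import Relation.Binary.Construct.Closure.Transitive using (TransClosure)
open import Function.Bundles using (_⇔_)

record Graph (n : ℕ) : Set₁ where
  field
    E       : Rel (Fin n) 0ℓ
    E-sym   : ∀ {u v} → E u v → E v u
    E-irrefl : ∀ {u} → ¬ E u u
open Graph public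

IsModule : ∀ {n} → Graph n → Subset n → Set
IsModule G M = Nonempty M ×
  (∀ u x x′ → u ∉ M → x ∈ M → x′ ∈ M → (E G u x ⇔ E G u x′))

Prime : ∀ {n} → Graph n → Set
Prime {n} G = ∀ (M : Subset n) → IsModule G M →
  (M ≡ ⊤) ⊎ ∃ λ (v : Fin n) → M ≡ ⁅ v ⁆

StrictLinearOrder : ∀ {n} → Rel (Fin n) 0ℓ → Set
StrictLinearOrder _<_ = IsStrictTotalOrder _≡_ _<_

IsRealizer : ∀ {n} → Graph n → Rel (Fin n) 0ℓ → Rel (Fin n) 0ℓ → Set
IsRealizer G _<₁_ _<₂_ =
  StrictLinearOrder _<₁_ × StrictLinearOrder _<₂_ ×
  (∀ u v → ¬ u ≡ v →
    (E G u v ⇔ ((u <₁ v × v <₂ u) ⊎ (v <₁ u × u <₂ v))))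

-- Closure under E of (r , r′) in the component of r (r′ is the other one):
-- r ∪ {(v,u) | u r′ v, {u,v} ∈ E} ∪ {(u,v) | u r′ v, {u,v} ∉ E}.
closeE : ∀ {n} → Graph n → Rel (Fin n) 0ℓ → Rel (Fin n) 0ℓ → Rel (Fin n) 0ℓ
closeE G r r′ x y = r x y ⊎ (r′ y x × E G y x) ⊎ (r′ x y × ¬ E G x y)

RelPair : ℕ → Set₁
RelPair n = Rel (Fin n) 0ℓ × Rel (Fin n) 0ℓ

step : ∀ {n} → Graph n → RelPair n → RelPair n
step G (r₁ , r₂) = TransClosure (closeE G r₁ r₂) , TransClosure (closeE G r₂ r₁)

seqW : ∀ {n} → Graph n → Fin n → ℕ → RelPair n
seqW G w zero    = (λ x y → x ≡ w × ¬ y ≡ w) , (λ _ _ → ⊥)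
seqW G w (suc k) = step G (seqW G w k)

-- The stabilized relations ◁_i^w: since the sequence is increasing,
-- its eventual (stable) value is the union over all k.
◁₁ : ∀ {n} → Graph n → Fin n → Rel (Fin n) 0ℓ
◁₁ G w x y = ∃ λ k → proj₁ (seqW G w k) x y

◁₂ : ∀ {n} → Graph n → Fin n → Rel (Fin n) 0ℓ
◁₂ G w x y = ∃ λ k → proj₂ (seqW G w k) x y

-- Every ◁ᵢ[k] is contained in <ᵢ, so it remains to show <₁ ⊆ ◁₁ (and then <₂ ⊆ ◁₂
-- follows from one closure step). Take any decidable relation K ⊆ ◁₁ that already has
-- w as least element, is transitive, and whose induced relation on the other side is
-- transitive on distinct pairs. If K left two distinct vertices x, y incomparable, the
-- K-incomparability component of x would be a module: a vertex outside it is
-- K-comparable to every member, and the two transitivity properties force it to see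
-- incomparable members alike. This module contains x and y but not w, contradicting
-- primality; so K is total, hence K ⊇ <₁. Such a K is obtained by saturation: as long
-- as one of the three closure properties fails, the failure exhibits a new pair of ◁₁.

module Submission where

open import Defs
open import Level using (0ℓ)
open import Data.Nat using (ℕ; zero; suc; _*_; _⊔_; _≤_; _≤′_; ≤′-refl; ≤′-step)
open import Data.Nat.Properties using (m≤m⊔n; m≤n⊔m; ≤⇒≤′)
open import Data.Fin using (Fin; combine; remQuot; _≟_)
open import Data.Fin.Properties using (any?; remQuot-combine)
open import Data.Fin.Subset using (Subset; _∈_; _∉_; _⊂_; _⊃_; _∪_; ⁅_⁆) renaming (⊥ to ∅)
open import Data.Fin.Subset.Properties
  using (_∈?_; ∉⊥; ∈⊤; p⊆p∪q; x∈p∪q⁺; x∈p∪q⁻; x∈⁅x⁆; x∈⁅y⁆⇒x≡y)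
open import Data.Fin.Subset.Induction using (⊃-wellFounded; Acc; acc)
open import Data.Product using (_×_; _,_; ∃; proj₁; proj₂; uncurry)
import Data.Product as Prod
open import Data.Sum using (_⊎_; inj₁; inj₂)
import Data.Sum as Sum
open import Data.Empty using (⊥; ⊥-elim)
open import Relation.Nullary using (¬_; yes; no)
open import Relation.Nullary.Decidable using (map′; _×-dec_; _⊎-dec_; ¬?; decidable-stable)
open import Relation.Binary.Core using (Rel; _⇒_)
open import Relation.Binary.Definitions using (Decidable; Transitive; Tri; tri<; tri≈; tri>)
open import Relation.Binary.Structures using (IsStrictTotalOrder)
open import Relation.Binary.PropositionalEquality
  using (_≡_; _≢_; refl; sym; trans; subst; isEquivalence)
open import Relation.Binary.Construct.Closure.Transitive using (TransClosure; [_]; _∷_)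
open import Function using (_∘_)
open import Function.Bundles using (_⇔_; mk⇔; Equivalence)
import Function.Properties.Equivalence as ⇔

private
  variable
    n : ℕ
    _<₁_ _<₂_ r s : Rel (Fin n) 0ℓ

saturate : ∀ {N} (P : Fin N → Set) (Done : Subset N → Set) →
  (∀ K → (∀ {i} → i ∈ K → P i) → Done K ⊎ ∃ λ i → i ∉ K × P i) →
  ∃ λ K → (∀ {i} → i ∈ K → P i) × Done K
saturate {N} P Done grow = go ∅ (⊃-wellFounded ∅) (⊥-elim ∘ ∉⊥)
  where
  go : ∀ K → Acc _⊃_ K → (∀ {i} → i ∈ K → P i) → ∃ λ K → (∀ {i} → i ∈ K → P i) × Done K
  go K (acc rec) K⊆P with grow K K⊆P
  ... | inj₁ done = K , K⊆P , done
  ... | inj₂ (i , i∉K , Pi) = go (K ∪ ⁅ i ⁆) (rec K⊂K∪i) K∪i⊆P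
    where
    K⊂K∪i : K ⊂ K ∪ ⁅ i ⁆
    K⊂K∪i = p⊆p∪q ⁅ i ⁆ , i , x∈p∪q⁺ (inj₂ (x∈⁅x⁆ i)) , i∉K
    K∪i⊆P : ∀ {j} → j ∈ K ∪ ⁅ i ⁆ → P j
    K∪i⊆P j∈ with x∈p∪q⁻ K ⁅ i ⁆ j∈
    ... | inj₁ j∈K = K⊆P j∈K
    ... | inj₂ j∈i rewrite x∈⁅y⁆⇒x≡y i j∈i = Pi

isStrictTotalOrder-⇔ : r ⇒ s → s ⇒ r → StrictLinearOrder s → StrictLinearOrder r
isStrictTotalOrder-⇔ {r = r} {s = s} r⇒s s⇒r sto = record
  { isStrictPartialOrder = record
    { isEquivalence = isEquivalence
    ; irrefl        = λ x≡y → S.irrefl x≡y ∘ r⇒s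
    ; trans         = λ rxy ryz → s⇒r (S.trans (r⇒s rxy) (r⇒s ryz))
    ; <-resp-≈      = (λ { refl rxy → rxy }) , (λ { refl rxy → rxy })
    }
  ; compare = compare
  }
  where
  module S = IsStrictTotalOrder sto
  compare : ∀ x y → Tri (r x y) (x ≡ y) (r y x)
  compare x y with S.compare x y
  ... | tri< a b c = tri< (s⇒r a) b (c ∘ r⇒s)
  ... | tri≈ a b c = tri≈ (a ∘ r⇒s) b (c ∘ r⇒s)
  ... | tri> a b c = tri> (a ∘ r⇒s) b (s⇒r c)

TransClosure-least : Transitive s → r ⇒ s → TransClosure r ⇒ s
TransClosure-least s-trans r⇒s [ p ]    = r⇒s p
TransClosure-least s-trans r⇒s (p ∷ ps) = s-trans (r⇒s p) (TransClosure-least s-trans r⇒s ps)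

-- The relation that one order of the closure under E contributes to the other one:
-- closeE G r r′ x y is definitionally r x y ⊎ induced G r′ x y.
induced : Graph n → Rel (Fin n) 0ℓ → Rel (Fin n) 0ℓ
induced G r x y = (r y x × E G y x) ⊎ (r x y × ¬ E G x y)

induced-mono : ∀ G → r ⇒ s → induced {n} G r ⇒ induced G s
induced-mono G r⇒s = Sum.map (Prod.map₁ r⇒s) (Prod.map₁ r⇒s)

induced? : ∀ G → Decidable (E G) → Decidable r → Decidable (induced {n} G r)
induced? G E? r? x y = (r? y x ×-dec E? y x) ⊎-dec (r? x y ×-dec ¬? (E? x y))

IsRealizer-swap : ∀ G → IsRealizer {n} G _<₁_ _<₂_ → IsRealizer G _<₂_ _<₁_
IsRealizer-swap G (so₁ , so₂ , adj) = so₂ , so₁ , λ u v u≢v →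
  mk⇔ (swap ∘ Equivalence.to (adj u v u≢v)) (Equivalence.from (adj u v u≢v) ∘ swap)
  where
  swap : ∀ {A B C D : Set} → (A × B) ⊎ (C × D) → (D × C) ⊎ (B × A)
  swap = Sum.swap ∘ Sum.map Prod.swap Prod.swap

E-decidable : ∀ G → IsRealizer {n} G _<₁_ _<₂_ → Decidable (E G)
E-decidable G (so₁ , so₂ , adj) u v with u ≟ v
... | yes refl = no (E-irrefl G)
... | no u≢v = map′ (Equivalence.from (adj u v u≢v)) (Equivalence.to (adj u v u≢v))
  ((u <₁? v ×-dec v <₂? u) ⊎-dec (v <₁? u ×-dec u <₂? v))
  where
  open IsStrictTotalOrder so₁ renaming (_<?_ to _<₁?_)
  open IsStrictTotalOrder so₂ renaming (_<?_ to _<₂?_)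

induced⇒ : ∀ G → IsRealizer {n} G _<₁_ _<₂_ → induced G _<₂_ ⇒ _<₁_
induced⇒ G (so₁ , so₂ , adj) {x} {y} (inj₁ (y<₂x , e))
  with Equivalence.to (adj y x (λ { refl → E-irrefl G e })) e
... | inj₁ (_ , x<₂y) = ⊥-elim (IsStrictTotalOrder.asym so₂ y<₂x x<₂y)
... | inj₂ (x<₁y , _) = x<₁y
induced⇒ G (so₁ , so₂ , adj) {x} {y} (inj₂ (x<₂y , ¬e))
  with IsStrictTotalOrder.compare so₁ x y
... | tri< x<₁y _ _ = x<₁y
... | tri≈ _ refl _ = ⊥-elim (IsStrictTotalOrder.irrefl so₂ refl x<₂y)
... | tri> _ x≢y y<₁x = ⊥-elim (¬e (Equivalence.from (adj x y x≢y) (inj₂ (y<₁x , x<₂y))))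

⇒induced : ∀ G → IsRealizer {n} G _<₁_ _<₂_ → _<₂_ ⇒ induced G _<₁_
⇒induced G R {x} {y} x<₂y with E-decidable G R y x
... | yes e = inj₁ (induced⇒ G R (inj₁ (x<₂y , E-sym G e)) , e)
... | no ¬e = inj₂ (induced⇒ G R (inj₂ (x<₂y , ¬e ∘ E-sym G)) , ¬e ∘ E-sym G)

closeE⇒ : ∀ G → IsRealizer {n} G _<₁_ _<₂_ → r ⇒ _<₁_ → s ⇒ _<₂_ → closeE G r s ⇒ _<₁_
closeE⇒ G R r⇒<₁ s⇒<₂ (inj₁ p) = r⇒<₁ p
closeE⇒ G R r⇒<₁ s⇒<₂ (inj₂ q) = induced⇒ G R (induced-mono G s⇒<₂ q)

step⇒ : ∀ G → IsRealizer {n} G _<₁_ _<₂_ → r ⇒ _<₁_ → s ⇒ _<₂_ →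
  (proj₁ (step G (r , s)) ⇒ _<₁_) × (proj₂ (step G (r , s)) ⇒ _<₂_)
step⇒ G R@(so₁ , so₂ , _) r⇒<₁ s⇒<₂ =
  TransClosure-least (IsStrictTotalOrder.trans so₁) (closeE⇒ G R r⇒<₁ s⇒<₂) ,
  TransClosure-least (IsStrictTotalOrder.trans so₂) (closeE⇒ G (IsRealizer-swap G R) s⇒<₂ r⇒<₁)

module PrimeTotality (G : Graph n) (prime : Prime G) (E? : Decidable (E G))
  {K : Rel (Fin n) 0ℓ} (K? : Decidable K) (w : Fin n) (K-from-w : ∀ v → v ≢ w → K w v)
  (K-trans : Transitive K)
  (induced-trans : ∀ {a b c} → induced G K a b → induced G K b c → a ≢ c → induced G K a c)
  where

  Comparable : Rel (Fin n) 0ℓ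
  Comparable a b = K a b ⊎ K b a

  Incomparable : Rel (Fin n) 0ℓ
  Incomparable a b = a ≢ b × ¬ K a b × ¬ K b a

  Incomparable? : Decidable Incomparable
  Incomparable? a b = ¬? (a ≟ b) ×-dec ¬? (K? a b) ×-dec ¬? (K? b a)

  Incomparable-sym : ∀ {a b} → Incomparable a b → Incomparable b a
  Incomparable-sym (a≢b , ¬ab , ¬ba) = a≢b ∘ sym , ¬ba , ¬ab

  adjacent-across-Incomparable : ∀ {p q v} → Incomparable p q →
    Comparable v p → Comparable v q → E G v p → E G v q
  adjacent-across-Incomparable {p} {q} {v} (p≢q , ¬pq , ¬qp) vp vq e with E? v q
  ... | yes e′ = e′
  ... | no ¬e′ = ⊥-elim (impossible vp vq)
    where
    impossible : Comparable v p → Comparable v q → ⊥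
    impossible (inj₁ Kvp) (inj₁ Kvq) = Sum.[ ¬qp ∘ proj₁ , ¬pq ∘ proj₁ ]
      (induced-trans (inj₁ (Kvp , e)) (inj₂ (Kvq , ¬e′)) p≢q)
    impossible (inj₁ Kvp) (inj₂ Kqv) = ¬qp (K-trans Kqv Kvp)
    impossible (inj₂ Kpv) (inj₁ Kvq) = ¬pq (K-trans Kpv Kvq)
    impossible (inj₂ Kpv) (inj₂ Kqv) = Sum.[ ¬pq ∘ proj₁ , ¬qp ∘ proj₁ ]
      (induced-trans (inj₂ (Kqv , ¬e′ ∘ E-sym G)) (inj₁ (Kpv , E-sym G e)) (p≢q ∘ sym))

  module Component (x : Fin n) where

    data Reachable : Fin n → Set where
      start : Reachable x
      _▸_   : ∀ {a b} → Reachable a → Incomparable a b → Reachable b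

    Closed : Subset n → Set
    Closed M = x ∈ M × (∀ {a b} → a ∈ M → Incomparable a b → b ∈ M)

    component : ∃ λ M → (∀ {a} → a ∈ M → Reachable a) × Closed M
    component = saturate Reachable Closed grow
      where
      grow : ∀ M → (∀ {a} → a ∈ M → Reachable a) → Closed M ⊎ ∃ λ a → a ∉ M × Reachable a
      grow M M⊆R with x ∈? M
      ... | no x∉M = inj₂ (x , x∉M , start)
      ... | yes x∈M with any? (λ a → any? λ b → (a ∈? M) ×-dec Incomparable? a b ×-dec ¬? (b ∈? M))
      ... | yes (a , b , a∈M , ab , b∉M) = inj₂ (b , b∉M , M⊆R a∈M ▸ ab)
      ... | no ∄ = inj₁ (x∈M , λ {a} {b} a∈M ab →
                     decidable-stable (b ∈? M) λ b∉M → ∄ (a , b , a∈M , ab , b∉M))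

    M : Subset n
    M = proj₁ component

    M-reachable : ∀ {a} → a ∈ M → Reachable a
    M-reachable = proj₁ (proj₂ component)

    x∈M : x ∈ M
    x∈M = proj₁ (proj₂ (proj₂ component))

    M-closed : ∀ {a b} → a ∈ M → Incomparable a b → b ∈ M
    M-closed = proj₂ (proj₂ (proj₂ component))

    reachable⇒∈M : ∀ {a} → Reachable a → a ∈ M
    reachable⇒∈M start    = x∈M
    reachable⇒∈M (r ▸ ab) = M-closed (reachable⇒∈M r) ab

    outside-comparable : ∀ {u a} → u ∉ M → a ∈ M → Comparable u a
    outside-comparable {u} {a} u∉M a∈M with K? u a | K? a u
    ... | yes Kua | _       = inj₁ Kua
    ... | no _    | yes Kau = inj₂ Kau
    ... | no ¬ua  | no ¬au  = ⊥-elim (u∉M (M-closed a∈M (a≢u , ¬au , ¬ua)))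
      where
      a≢u : a ≢ u
      a≢u refl = u∉M a∈M

    neighbour-invariant : ∀ {u a} → u ∉ M → Reachable a → E G u x ⇔ E G u a
    neighbour-invariant u∉M start    = ⇔.refl
    neighbour-invariant {u} u∉M (_▸_ {a} {b} r ab) = ⇔.trans (neighbour-invariant u∉M r) (mk⇔
      (adjacent-across-Incomparable ab ua ub)
      (adjacent-across-Incomparable (Incomparable-sym ab) ub ua))
      where
      ua : Comparable u a
      ua = outside-comparable u∉M (reachable⇒∈M r)
      ub : Comparable u b
      ub = outside-comparable u∉M (reachable⇒∈M (r ▸ ab))

    M-isModule : IsModule G M
    M-isModule = (x , x∈M) , λ u a b u∉M a∈M b∈M →
      ⇔.trans (⇔.sym (neighbour-invariant u∉M (M-reachable a∈M)))
              (neighbour-invariant u∉M (M-reachable b∈M))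

    reachable-≢w : x ≢ w → ∀ {a} → Reachable a → a ≢ w
    reachable-≢w x≢w start                        = x≢w
    reachable-≢w x≢w (r ▸ (a≢b , _ , ¬ba)) refl = ¬ba (K-from-w _ a≢b)

    ¬Incomparable : ∀ {y} → ¬ Incomparable x y
    ¬Incomparable {y} xy@(x≢y , ¬xy , _) with prime M M-isModule
    ... | inj₁ M≡⊤ = reachable-≢w x≢w (M-reachable (subst (w ∈_) (sym M≡⊤) ∈⊤)) refl
      where
      x≢w : x ≢ w
      x≢w refl = ¬xy (K-from-w y (x≢y ∘ sym))
    ... | inj₂ (v , M≡v) = x≢y (trans (∈v x∈M) (sym (∈v (M-closed x∈M xy))))
      where
      ∈v : ∀ {a} → a ∈ M → a ≡ v
      ∈v a∈M = x∈⁅y⁆⇒x≡y v (subst (_ ∈_) M≡v a∈M)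

  K-total : ∀ {x y} → x ≢ y → Comparable x y
  K-total {x} {y} x≢y with K? x y | K? y x
  ... | yes Kxy | _       = inj₁ Kxy
  ... | no _    | yes Kyx = inj₂ Kyx
  ... | no ¬xy  | no ¬yx  = ⊥-elim (Component.¬Incomparable x (x≢y , ¬xy , ¬yx))

module Sequence (G : Graph n) (w : Fin n) where

  ◁₁[_] ◁₂[_] : ℕ → Rel (Fin n) 0ℓ
  ◁₁[ k ] = proj₁ (seqW G w k)
  ◁₂[ k ] = proj₂ (seqW G w k)

  seqW-mono : ∀ {k m} → k ≤ m → (◁₁[ k ] ⇒ ◁₁[ m ]) × (◁₂[ k ] ⇒ ◁₂[ m ])
  seqW-mono = mono′ ∘ ≤⇒≤′
    where
    mono′ : ∀ {k m} → k ≤′ m → (◁₁[ k ] ⇒ ◁₁[ m ]) × (◁₂[ k ] ⇒ ◁₂[ m ])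
    mono′ ≤′-refl       = (λ p → p) , (λ p → p)
    mono′ (≤′-step k≤m) = (λ p → [ inj₁ (proj₁ (mono′ k≤m) p) ]) ,
                          (λ p → [ inj₁ (proj₂ (mono′ k≤m) p) ])

  ◁₁-trans : Transitive (◁₁ G w)
  ◁₁-trans (k , p) (m , q) = suc (k ⊔ m) ,
    inj₁ (proj₁ (seqW-mono (m≤m⊔n k m)) p) ∷ [ inj₁ (proj₁ (seqW-mono (m≤n⊔m k m)) q) ]

  ◁₂-trans : Transitive (◁₂ G w)
  ◁₂-trans (k , p) (m , q) = suc (k ⊔ m) ,
    inj₁ (proj₂ (seqW-mono (m≤m⊔n k m)) p) ∷ [ inj₁ (proj₂ (seqW-mono (m≤n⊔m k m)) q) ]

  induced-◁₂⇒◁₁ : induced G (◁₂ G w) ⇒ ◁₁ G w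
  induced-◁₂⇒◁₁ (inj₁ ((k , p) , e))  = suc k , [ inj₂ (inj₁ (p , e)) ]
  induced-◁₂⇒◁₁ (inj₂ ((k , p) , ¬e)) = suc k , [ inj₂ (inj₂ (p , ¬e)) ]

  induced-◁₁⇒◁₂ : induced G (◁₁ G w) ⇒ ◁₂ G w
  induced-◁₁⇒◁₂ (inj₁ ((k , p) , e))  = suc k , [ inj₂ (inj₁ (p , e)) ]
  induced-◁₁⇒◁₂ (inj₂ ((k , p) , ¬e)) = suc k , [ inj₂ (inj₂ (p , ¬e)) ]

  module _ (R : IsRealizer G _<₁_ _<₂_) (w-first : ∀ v → v ≢ w → w <₁ v) where

    seqW⇒realizer : ∀ k → (◁₁[ k ] ⇒ _<₁_) × (◁₂[ k ] ⇒ _<₂_)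
    seqW⇒realizer zero    = (λ { (refl , v≢w) → w-first _ v≢w }) , λ ()
    seqW⇒realizer (suc k) = step⇒ G R (proj₁ (seqW⇒realizer k)) (proj₂ (seqW⇒realizer k))

    ◁₁⇒<₁ : ◁₁ G w ⇒ _<₁_
    ◁₁⇒<₁ (k , p) = proj₁ (seqW⇒realizer k) p

    ◁₂⇒<₂ : ◁₂ G w ⇒ _<₂_
    ◁₂⇒<₂ (k , p) = proj₂ (seqW⇒realizer k) p

module Completeness (G : Graph n) (prime : Prime G) (R : IsRealizer G _<₁_ _<₂_)
  (w : Fin n) (w-first : ∀ v → v ≢ w → w <₁ v) where

  open Sequence G w

  E? : Decidable (E G)
  E? = E-decidable G R

  -- A finite set of pairs, i.e. a decidable relation, encoded as a subset of Fin (n * n).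
  ⟦_⟧ : Subset (n * n) → Rel (Fin n) 0ℓ
  ⟦ K ⟧ a b = combine a b ∈ K

  ⟦_⟧? : ∀ K → Decidable ⟦ K ⟧
  ⟦ K ⟧? a b = combine a b ∈? K

  In◁₁ : Fin (n * n) → Set
  In◁₁ i = uncurry (◁₁ G w) (remQuot n i)

  Sound : Subset (n * n) → Set
  Sound K = ∀ {i} → i ∈ K → In◁₁ i

  NewPair : Subset (n * n) → Set
  NewPair K = ∃ λ i → i ∉ K × In◁₁ i

  new : ∀ {K a b} → ¬ ⟦ K ⟧ a b → ◁₁ G w a b → NewPair K
  new {a = a} {b} ∉K p = combine a b , ∉K , subst (uncurry (◁₁ G w)) (sym (remQuot-combine a b)) p

  ⟦⟧⇒◁₁ : ∀ {K} → Sound K → ⟦ K ⟧ ⇒ ◁₁ G w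
  ⟦⟧⇒◁₁ K-sound {a} {b} ab = subst (uncurry (◁₁ G w)) (remQuot-combine a b) (K-sound ab)

  module _ (K : Subset (n * n)) (K-sound : Sound K) where

    from-w-or-new : (∀ v → v ≢ w → ⟦ K ⟧ w v) ⊎ NewPair K
    from-w-or-new with any? (λ v → ¬? (v ≟ w) ×-dec ¬? (⟦ K ⟧? w v))
    ... | yes (v , v≢w , ∉K) = inj₂ (new ∉K (0 , refl , v≢w))
    ... | no ∄ = inj₁ λ v v≢w → decidable-stable (⟦ K ⟧? w v) λ ∉K → ∄ (v , v≢w , ∉K)

    trans-or-new : Transitive ⟦ K ⟧ ⊎ NewPair K
    trans-or-new with any? (λ a → any? λ b → any? λ c →
                        ⟦ K ⟧? a b ×-dec ⟦ K ⟧? b c ×-dec ¬? (⟦ K ⟧? a c))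
    ... | yes (a , b , c , ab , bc , ∉K) =
      inj₂ (new ∉K (◁₁-trans (⟦⟧⇒◁₁ K-sound ab) (⟦⟧⇒◁₁ K-sound bc)))
    ... | no ∄ = inj₁ λ {a} {b} {c} ab bc →
                   decidable-stable (⟦ K ⟧? a c) λ ∉K → ∄ (a , b , c , ab , bc , ∉K)

    induced-trans-or-new : (∀ {a b c} → induced G ⟦ K ⟧ a b → induced G ⟦ K ⟧ b c → a ≢ c →
                                        induced G ⟦ K ⟧ a c) ⊎ NewPair K
    induced-trans-or-new with any? (λ a → any? λ b → any? λ c → induced? G E? ⟦ K ⟧? a b
      ×-dec induced? G E? ⟦ K ⟧? b c ×-dec ¬? (a ≟ c) ×-dec ¬? (induced? G E? ⟦ K ⟧? a c))
    ... | yes (a , b , c , ab , bc , _ , ∉K) with ◁₂-trans (lift ab) (lift bc) | E? c a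
      where
      lift : induced G ⟦ K ⟧ ⇒ ◁₂ G w
      lift = induced-◁₁⇒◁₂ ∘ induced-mono G (⟦⟧⇒◁₁ K-sound)
    ... | ac | yes e = inj₂ (new (∉K ∘ inj₁ ∘ (_, e)) (induced-◁₂⇒◁₁ (inj₁ (ac , E-sym G e))))
    ... | ac | no ¬e =
      inj₂ (new (∉K ∘ inj₂ ∘ (_, ¬e ∘ E-sym G)) (induced-◁₂⇒◁₁ (inj₂ (ac , ¬e ∘ E-sym G))))
    induced-trans-or-new | no ∄ = inj₁ λ {a} {b} {c} ab bc a≢c →
      decidable-stable (induced? G E? ⟦ K ⟧? a c) λ ∉K → ∄ (a , b , c , ab , bc , a≢c , ∉K)

    <₁⇒⟦⟧-or-new : (_<₁_ ⇒ ⟦ K ⟧) ⊎ NewPair K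
    <₁⇒⟦⟧-or-new with from-w-or-new | trans-or-new | induced-trans-or-new
    ... | inj₂ p | _      | _      = inj₂ p
    ... | inj₁ _ | inj₂ p | _      = inj₂ p
    ... | inj₁ _ | inj₁ _ | inj₂ p = inj₂ p
    ... | inj₁ from-w | inj₁ K-trans | inj₁ induced-trans = inj₁ λ {x} {y} x<₁y →
      Sum.[ (λ Kxy → Kxy) , (λ Kyx → ⊥-elim (asym x<₁y (◁₁⇒<₁ R w-first (⟦⟧⇒◁₁ K-sound Kyx)))) ]
      (K-total (λ { refl → irrefl refl x<₁y }))
      where
      open IsStrictTotalOrder (proj₁ R)
      open PrimeTotality G prime E? ⟦ K ⟧? w from-w K-trans induced-trans

  <₁⇒◁₁ : _<₁_ ⇒ ◁₁ G w
  <₁⇒◁₁ with saturate In◁₁ (λ K → _<₁_ ⇒ ⟦ K ⟧) <₁⇒⟦⟧-or-new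
  ... | K , K-sound , <₁⊆K = ⟦⟧⇒◁₁ K-sound ∘ <₁⊆K

  <₂⇒◁₂ : _<₂_ ⇒ ◁₂ G w
  <₂⇒◁₂ = induced-◁₁⇒◁₂ ∘ induced-mono G <₁⇒◁₁ ∘ ⇒induced G R

theorem5p6 : ∀ {n} (G : Graph n) → Prime G →
    (_<₁_ _<₂_ : Rel (Fin n) 0ℓ) → IsRealizer G _<₁_ _<₂_ →
    (w : Fin n) → (∀ v → ¬ v ≡ w → w <₁ v) →
    StrictLinearOrder (◁₁ G w) × StrictLinearOrder (◁₂ G w)
theorem5p6 G prime _<₁_ _<₂_ R w w-first =
  isStrictTotalOrder-⇔ (◁₁⇒<₁ R w-first) <₁⇒◁₁ (proj₁ R) ,
  isStrictTotalOrder-⇔ (◁₂⇒<₂ R w-first) <₂⇒◁₂ (proj₁ (proj₂ R))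
  where
  open Sequence G w
  open Completeness G prime R w w-first
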